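{- Let $T$ be a profinite tangle with $s(T)=t(T)=\uparrow$ and define its transpose ${}^tT:=a^{\frown_{\downarrow\uparrow}\downarrow}_{0,1}\cdot(e^\downarrow_1\otimes T\otimes e^\downarrow_1)\cdot c^{\downarrow\smile_{\uparrow\downarrow}}_{1,0}$. Then ${}^tT$ is isotopic to $a^{\downarrow\frown_{\uparrow\downarrow}}_{1,0}\cdot(e^\downarrow_1\otimes T\otimes e^\downarrow_1)\cdot c^{\smile_{\downarrow\uparrow}\downarrow}_{0,1}$. Similarly, if $s(T)=t(T)=\downarrow$, then $a^{\frown_{\uparrow\downarrow}\uparrow}_{0,1}\cdot(e^\uparrow_1\otimes T\otimes e^\uparrow_1)\cdot c^{\uparrow\smile_{\downarrow\uparrow}}_{1,0}$ is isotopic to $a^{\uparrow\frown_{\downarrow\uparrow}}_{1,0}\cdot(e^\uparrow_1\otimes T\otimes e^\uparrow_1)\cdot c^{\smile_{\uparrow\downarrow}\uparrow}_{0,1}$ (this being the transpose in that case).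
   Context: $\widehat B_n$: profinite completion of the Artin braid group $B_n$ on $\sigma_1,\dots,\sigma_{n-1}$, unit $e_n$; $b(k)$ the image of $k$ under the permutation of $b$; in $b\cdot b'$, $b$ is on top. Fundamental profinite tangles: (A) $a^\epsilon_{k,l}$, $\epsilon=\epsilon_1\kappa\epsilon_2$ with $\epsilon_1,\epsilon_2$ words in $\{\uparrow,\downarrow\}$ of lengths $k,l$ and $\kappa\in\{\frown_{\uparrow\downarrow},\frown_{\downarrow\uparrow}\}$; source $\epsilon$ with $\frown_{uv}$ replaced by $uv$, target $\epsilon_1\epsilon_2$ (a cap joining bottom points $k+1,k+2$); (B) $(b,\epsilon)$, $b\in\widehat B_n$, source $\epsilon$, target with $b(i)$-th letter equal to the $i$-th letter of $\epsilon$; (C) $c^\epsilon_{k,l}$ with $\kappa\in\{\smile_{\uparrow\downarrow},\smile_{\downarrow\uparrow}\}$, source $\epsilon_1\epsilon_2$, target $\epsilon$ with $\smile_{uv}$ replaced by $uv$ (cup joining top points $k+1,k+2$). Profinite tangles: finite sequences $\gamma_N\cdots\gamma_1$ with $s(\gamma_{i+1})=t(\gamma_i)$; $s(T)=s(\gamma_1)$, $t(T)=t(\gamma_N)$. $e^\epsilon_n=(e_n,\epsilon)$; $e^{\epsilon_1}_{n_1}\otimes\gamma\otimes e^{\epsilon_2}_{n_2}$ adds parallel strands oriented $\epsilon_1$ on the left and $\epsilon_2$ on the right (for braids via $\sigma_i\mapsto\sigma_{n_1+i}$), termwise on sequences. $ev_{k,\epsilon_0}(b^\epsilon_l)$, $ev^{k,\epsilon_0}(b^\epsilon_l)$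 replace the strand starting at bottom position $k$, resp. ending at top position $k$, by parallel strands oriented $\epsilon_0$. Isotopy: equivalence generated by (T1) $e^{t(T)}T=T=Te^{s(T)}$; (T2) $(b_2,\epsilon_2)(b_1,\epsilon_1)=(b_2b_1,\epsilon_1)$; (T3) $(e^{t(T_1)}\otimes T_2)(T_1\otimes e^{s(T_2)})=(T_1\otimes e^{t(T_2)})(e^{s(T_1)}\otimes T_2)$; (T4) $ev_{k,t(T)}(b^\epsilon_l)(e^{s_1}_{k-1}\otimes T\otimes e^{s_2}_{l-k})=(e^{t_1}_{k'-1}\otimes T\otimes e^{t_2}_{l-k'})ev^{k',s(T)}(b^\epsilon_l)$, $k'=b(k)$, $s_i,t_i$ the corresponding sub-words of source/target; (T5) $a^{\epsilon'}_{k+1,l-1}c^\epsilon_{k,l}=e^{s(c^\epsilon_{k,l})}_{k+l}=a^{\epsilon'}_{k-1,l+1}c^\epsilon_{k,l}$; (T6) $(\sigma^c_{k+1},\epsilon')c^\epsilon_{k,l}=c^{\bar\epsilon}_{k,l}$, $a^\epsilon_{k,l}(\sigma^c_{k+1},\epsilon')=a^{\bar\epsilon}_{k,l}$ for $c\in\widehat{\mathbb Z}$, $\sigma_{k+1}\in\widehat B_{k+l+2}$, $\bar\epsilon$ making the equation consistent; moves are applied to consecutive subsequences. -}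

module Defs where

open import Level using (0ℓ; Lift) renaming (suc to lsuc)
open import Algebra.Bundles using (Group)
open import Algebra.Morphism.Structures using (IsGroupHomomorphism)
open import Data.Nat using (ℕ; zero; suc; _+_; _∸_; _≤_; _<_; _≡ᵇ_; _<ᵇ_)
open import Data.Nat.Properties using (≤-trans; m≤n+m; m≤m+n; +-monoʳ-≤; +-monoʳ-<; +-assoc; +-suc)
open import Data.Bool using (Bool; true; false; if_then_else_)
open import Data.List using (List; []; _∷_; _++_; length; map; upTo; reverse; take; drop) renaming ([_] to L[_])
open import Data.List.Properties using (length-++; ++-assoc)
open import Data.List.Relation.Unary.Any using (Any)
open import Data.List.Relation.Unary.All using (All)
open import Data.Maybe using (Maybe; just; nothing)
open import Data.Product using (Σ; _×_; _,_; proj₁; proj₂)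
open import Data.Unit using (⊤)
open import Relation.Binary.PropositionalEquality using (_≡_; refl; sym; trans; cong; subst)

record FinGroup : Set₁ where
  field
    grp      : Group 0ℓ 0ℓ
    enum     : List (Group.Carrier grp)
    complete : ∀ x → Any (Group._≈_ grp x) enum

Car : FinGroup → Set
Car G = Group.Carrier (FinGroup.grp G)

Eq : (G : FinGroup) → Car G → Car G → Set
Eq G = Group._≈_ (FinGroup.grp G)

mul : (G : FinGroup) → Car G → Car G → Car G
mul G = Group._∙_ (FinGroup.grp G)

one : (G : FinGroup) → Car G
one G = Group.ε (FinGroup.grp G)

inv : (G : FinGroup) → Car G → Car G
inv G = Group._⁻¹ (FinGroup.grp G)

Hom : FinGroup → FinGroup → Set
Hom G H = Σ (Car G → Car H)
            (IsGroupHomomorphism (Group.rawGroup (FinGroup.grp G)) (Group.rawGroup (FinGroup.grp H)))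

-- Finite quotients of the Artin braid group B_n: a finite group G with
-- elements gen i (standing for the image of σ_i, 1 ≤ i < n; values of
-- gen outside this range are irrelevant) satisfying the braid relations.

record FQ (n : ℕ) : Set₁ where
  field
    G   : FinGroup
    gen : ℕ → Car G
    far : ∀ i j → 1 ≤ i → i + 2 ≤ j → j < n →
          Eq G (mul G (gen i) (gen j)) (mul G (gen j) (gen i))
    brd : ∀ i → 1 ≤ i → suc i < n →
          Eq G (mul G (mul G (gen i) (gen (suc i))) (gen i))
               (mul G (mul G (gen (suc i)) (gen i)) (gen (suc i)))

-- Profinite completion of B_n: families of elements of all finite
-- quotients, compatible with all homomorphisms of finite quotients.
record PBraid (n : ℕ) : Set₁ where
  field
    at      : (q : FQ n) → Car (FQ.G q)
    natural : ∀ (q q' : FQ n) (f : Hom (FQ.G q) (FQ.G q')) →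
              (∀ i → 1 ≤ i → i < n → Eq (FQ.G q') (proj₁ f (FQ.gen q i)) (FQ.gen q' i)) →
              Eq (FQ.G q') (proj₁ f (at q)) (at q')
open PBraid public

_≈B_ : ∀ {n} → PBraid n → PBraid n → Set₁
_≈B_ {n} b b' = Lift (lsuc 0ℓ) (∀ (q : FQ n) → Eq (FQ.G q) (at b q) (at b' q))

-- Profinite completion of ℤ (finite quotients of ℤ = finite groups with one element).
ZQ : Set₁
ZQ = Σ FinGroup Car

record PZ : Set₁ where
  field
    atZ      : (q : ZQ) → Car (proj₁ q)
    naturalZ : ∀ (q q' : ZQ) (f : Hom (proj₁ q) (proj₁ q')) →
               Eq (proj₁ q') (proj₁ f (proj₂ q)) (proj₂ q') →
               Eq (proj₁ q') (proj₁ f (atZ q)) (atZ q')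
open PZ public

unitB : ∀ {n} → PBraid n
at (unitB) q = one (FQ.G q)
natural (unitB) q q' f _ = IsGroupHomomorphism.ε-homo (proj₂ f)

-- b ·B b' : b on top
_·B_ : ∀ {n} → PBraid n → PBraid n → PBraid n
at (b ·B b') q = mul (FQ.G q) (at b q) (at b' q)
natural (b ·B b') q q' f h =
  Group.trans (FinGroup.grp (FQ.G q'))
    (IsGroupHomomorphism.homo (proj₂ f) (at b q) (at b' q))
    (Group.∙-cong (FinGroup.grp (FQ.G q')) (natural b q q' f h) (natural b' q q' f h))

σPow : (n i : ℕ) → 1 ≤ i → i < n → PZ → PBraid n
at (σPow n i r1 r2 c) q = atZ c (FQ.G q , FQ.gen q i)
natural (σPow n i r1 r2 c) q q' f h =
  naturalZ c (FQ.G q , FQ.gen q i) (FQ.G q' , FQ.gen q' i) f (h i r1 r2)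

private
  p1L : ∀ n1 i → 1 ≤ i → 1 ≤ n1 + i
  p1L n1 i r = ≤-trans r (m≤n+m i n1)

  p2L : ∀ n1 i j → i + 2 ≤ j → n1 + i + 2 ≤ n1 + j
  p2L n1 i j r = subst (_≤ n1 + j) (sym (+-assoc n1 i 2)) (+-monoʳ-≤ n1 r)

  p3L : ∀ n1 i n → suc i < n → suc (n1 + i) < n1 + n
  p3L n1 i n r = subst (λ z → suc z ≤ n1 + n) (+-suc n1 i) (+-monoʳ-< n1 r)

restrictL : ∀ n1 {n} → FQ (n1 + n) → FQ n
restrictL n1 {n} q = record
  { G   = FQ.G q
  ; gen = λ i → FQ.gen q (n1 + i)
  ; far = λ i j r1 r2 r3 → FQ.far q (n1 + i) (n1 + j) (p1L n1 i r1) (p2L n1 i j r2) (+-monoʳ-< n1 r3)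
  ; brd = λ i r1 r2 →
      subst (λ z → Eq (FQ.G q) (mul (FQ.G q) (mul (FQ.G q) (FQ.gen q (n1 + i)) (FQ.gen q z)) (FQ.gen q (n1 + i)))
                               (mul (FQ.G q) (mul (FQ.G q) (FQ.gen q z) (FQ.gen q (n1 + i))) (FQ.gen q z)))
            (sym (+-suc n1 i))
            (FQ.brd q (n1 + i) (p1L n1 i r1) (p3L n1 i n r2))
  }

shiftL : ∀ n1 {n} → PBraid n → PBraid (n1 + n)
at (shiftL n1 b) q = at b (restrictL n1 q)
natural (shiftL n1 b) q q' f h =
  natural b (restrictL n1 q) (restrictL n1 q') f (λ i r1 r2 → h (n1 + i) (p1L n1 i r1) (+-monoʳ-< n1 r2))

restrictR : ∀ {n} n2 → FQ (n + n2) → FQ n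
restrictR {n} n2 q = record
  { G   = FQ.G q
  ; gen = FQ.gen q
  ; far = λ i j r1 r2 r3 → FQ.far q i j r1 r2 (≤-trans r3 (m≤m+n n n2))
  ; brd = λ i r1 r2 → FQ.brd q i r1 (≤-trans r2 (m≤m+n n n2))
  }

shiftR : ∀ {n} n2 → PBraid n → PBraid (n + n2)
at (shiftR n2 b) q = at b (restrictR n2 q)
natural (shiftR {n} n2 b) q q' f h =
  natural b (restrictR n2 q) (restrictR n2 q') f (λ i r1 r2 → h i r1 (≤-trans r2 (m≤m+n n n2)))

-- Braid words (letters (i , false) = σ_i, (i , true) = σ_i⁻¹; the
-- leftmost letter is on top), their images in finite quotients, their
-- permutations, and the cabling of a strand.

Word : Set
Word = List (ℕ × Bool)

ValidWord : ℕ → Word → Set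
ValidWord n w = All (λ x → 1 ≤ proj₁ x × proj₁ x < n) w

eval : ∀ {n} (q : FQ n) → Word → Car (FQ.G q)
eval q []               = one (FQ.G q)
eval q ((i , false) ∷ w) = mul (FQ.G q) (FQ.gen q i) (eval q w)
eval q ((i , true) ∷ w)  = mul (FQ.G q) (inv (FQ.G q) (FQ.gen q i)) (eval q w)

swap : ℕ → ℕ → ℕ
swap i k = if k ≡ᵇ i then suc i else (if k ≡ᵇ suc i then i else k)

-- permw w k = image of the bottom position k under the permutation of w
permw : Word → ℕ → ℕ
permw []            k = k
permw ((i , _) ∷ w) k = swap i (permw w k)

-- b(k) = k'   (for b ∈ \hat B_n; determined through a finite quotient)
Perm : ∀ {n} → PBraid n → ℕ → ℕ → Set₁
Perm {n} b k k' =
  Σ (FQ n) λ q → ∀ (w : Word) → ValidWord n w →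
    Eq (FQ.G q) (eval q w) (at b q) → permw w k ≡ k'

-- cabling of one letter, when the distinguished strand sits (before the
-- letter acts) at position p and is replaced by m parallel strands
cabLetter : ℕ → ℕ → ℕ × Bool → Word
cabLetter p m (i , s) =
  if p ≡ᵇ i then map (λ j → (i + j , s)) (upTo m)
  else (if p ≡ᵇ suc i then map (λ j → (i + j , s)) (reverse (upTo m))
  else (if p <ᵇ i then L[ (i + m ∸ 1 , s) ] else L[ (i , s) ]))

cabw : ℕ → ℕ → Word → Word
cabw k m []      = []
cabw k m (x ∷ w) = cabLetter (permw w k) m x ++ cabw k m w

-- b' is the (continuous extension to profinite braids of the) cabling of
-- the strand of b starting at bottom position k into m parallel strands
Cab : ∀ {n N} → ℕ → ℕ → PBraid n → PBraid N → Set₁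
Cab {n} {N} k m b b' =
  ∀ (q' : FQ N) → Σ (FQ n) λ q → ∀ (w : Word) → ValidWord n w →
    Eq (FQ.G q) (eval q w) (at b q) → Eq (FQ.G q') (eval q' (cabw k m w)) (at b' q')

data Ori : Set where
  up down : Ori

OWord : Set
OWord = List Ori

data Kappa : Set where
  ud du : Kappa

fstK sndK : Kappa → Ori
fstK ud = up
fstK du = down
sndK ud = down
sndK du = up

-- 1-based lookup
_!_ : OWord → ℕ → Maybe Ori
[] ! _ = nothing
(x ∷ xs) ! zero = nothing
(x ∷ xs) ! suc zero = just x
(x ∷ xs) ! suc (suc k) = xs ! suc k

data FT : OWord → OWord → Set₁ where
  cap   : ∀ {s t} (e1 : OWord) (κ : Kappa) (e2 : OWord) →
          s ≡ e1 ++ fstK κ ∷ sndK κ ∷ e2 → t ≡ e1 ++ e2 → FT s t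
  -- (b , s) with target t (consistency of t is part of WF below)
  braid : ∀ {s t} → PBraid (length s) → FT s t
  cup   : ∀ {s t} (e1 : OWord) (κ : Kappa) (e2 : OWord) →
          s ≡ e1 ++ e2 → t ≡ e1 ++ fstK κ ∷ sndK κ ∷ e2 → FT s t

-- nonempty sequences γ_N ⋯ γ_1 (head = top)
data Tangle : OWord → OWord → Set₁ where
  [_] : ∀ {a b} → FT a b → Tangle a b
  _∷_ : ∀ {a b c} → FT b c → Tangle a b → Tangle a c

data Path : OWord → OWord → Set₁ where
  nil  : ∀ {a} → Path a a
  _∷ₚ_ : ∀ {a b c} → FT b c → Path a b → Path a c

-- T · U : T on top
_·_ : ∀ {a b c} → Tangle b c → Tangle a b → Tangle a c
[ γ ] · U   = γ ∷ U
(γ ∷ T) · U = γ ∷ (T · U)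

_▹_ : ∀ {x y b} → Path y b → Tangle x y → Tangle x b
nil ▹ T        = T
(γ ∷ₚ X) ▹ T   = γ ∷ (X ▹ T)

_◃_ : ∀ {a x y} → Tangle x y → Path a x → Tangle a y
T ◃ nil       = T
T ◃ (δ ∷ₚ Y)  = T · ([ δ ] ◃ Y)

idFT : ∀ {s} → FT s s
idFT = braid unitB

ftL : ∀ {s t} (ε : OWord) → FT s t → FT (ε ++ s) (ε ++ t)
ftL ε (cap e1 κ e2 ps pt) =
  cap (ε ++ e1) κ e2 (trans (cong (ε ++_) ps) (sym (++-assoc ε e1 _)))
                     (trans (cong (ε ++_) pt) (sym (++-assoc ε e1 e2)))
ftL {s} ε (braid b) = braid (subst PBraid (sym (length-++ ε {s})) (shiftL (length ε) b))
ftL ε (cup e1 κ e2 ps pt) =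
  cup (ε ++ e1) κ e2 (trans (cong (ε ++_) ps) (sym (++-assoc ε e1 e2)))
                     (trans (cong (ε ++_) pt) (sym (++-assoc ε e1 _)))

ftR : ∀ {s t} (ε : OWord) → FT s t → FT (s ++ ε) (t ++ ε)
ftR ε (cap e1 κ e2 ps pt) =
  cap e1 κ (e2 ++ ε) (trans (cong (_++ ε) ps) (++-assoc e1 _ ε))
                     (trans (cong (_++ ε) pt) (++-assoc e1 e2 ε))
ftR {s} ε (braid b) = braid (subst PBraid (sym (length-++ s {ε})) (shiftR (length ε) b))
ftR ε (cup e1 κ e2 ps pt) =
  cup e1 κ (e2 ++ ε) (trans (cong (_++ ε) ps) (++-assoc e1 e2 ε))
                     (trans (cong (_++ ε) pt) (++-assoc e1 _ ε))

tL : ∀ {s t} (ε : OWord) → Tangle s t → Tangle (ε ++ s) (ε ++ t)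
tL ε [ γ ]   = [ ftL ε γ ]
tL ε (γ ∷ T) = ftL ε γ ∷ tL ε T

tR : ∀ {s t} (ε : OWord) → Tangle s t → Tangle (s ++ ε) (t ++ ε)
tR ε [ γ ]   = [ ftR ε γ ]
tR ε (γ ∷ T) = ftR ε γ ∷ tR ε T

tens : ∀ {s t} (ε1 ε2 : OWord) → Tangle s t → Tangle (ε1 ++ (s ++ ε2)) (ε1 ++ (t ++ ε2))
tens ε1 ε2 T = tL ε1 (tR ε2 T)

rep : ℕ → OWord → OWord → OWord
rep k ε x = take (k ∸ 1) ε ++ (x ++ drop k ε)

WFft : ∀ {s t} → FT s t → Set₁
WFft (cap _ _ _ _ _) = Lift (lsuc 0ℓ) ⊤
WFft {s} {t} (braid b) =
  Lift (lsuc 0ℓ) (length t ≡ length s) ×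
  (∀ i k' → 1 ≤ i → i ≤ length s → Perm b i k' → Lift (lsuc 0ℓ) (t ! k' ≡ s ! i))
WFft (cup _ _ _ _ _) = Lift (lsuc 0ℓ) ⊤

WF : ∀ {a b} → Tangle a b → Set₁
WF [ γ ]   = WFft γ
WF (γ ∷ T) = WFft γ × WF T

data Move : ∀ {a b} → Tangle a b → Tangle a b → Set₁ where
  T1l : ∀ {a b} (T : Tangle a b) → Move (idFT ∷ T) T
  T1r : ∀ {a b} (T : Tangle a b) → Move (T · [ idFT ]) T
  T2  : ∀ {x y z} (b1 : PBraid (length x)) (b2 : PBraid (length y)) (p : length y ≡ length x) →
        Move (braid {y} {z} b2 ∷ [ braid {x} {y} b1 ])
             [ braid {x} {z} (subst PBraid p b2 ·B b1) ]
  -- profinite braids are taken up to their equality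
  Bcong : ∀ {x y} (b b' : PBraid (length x)) → b ≈B b' →
          Move [ braid {x} {y} b ] [ braid {x} {y} b' ]
  T3  : ∀ {a b c d} (T1 : Tangle a b) (T2 : Tangle c d) →
        Move (tL b T2 · tR c T1) (tR d T1 · tL a T2)
  T4  : ∀ {ε τ s t} (b : PBraid (length ε)) → WFft (braid {ε} {τ} b) →
        (k k' : ℕ) → 1 ≤ k → k ≤ length ε → Perm b k k' →
        (T : Tangle s t)
        (b1 : PBraid (length (rep k ε t))) (b2 : PBraid (length (rep k ε s))) →
        Cab k (length t) b b1 → Cab k (length s) b b2 →
        Move (braid {rep k ε t} {rep k' τ t} b1 ∷ tens (take (k ∸ 1) ε) (drop k ε) T)
             (tens (take (k' ∸ 1) τ) (drop k' τ) T · [ braid {rep k ε s} {rep k' τ s} b2 ])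
  T5a : ∀ {x y} (e1 e2 e1' e2' : OWord) (κ κ' : Kappa)
        (ps : x ≡ e1 ++ e2) (pt : y ≡ e1 ++ fstK κ ∷ sndK κ ∷ e2)
        (ps' : y ≡ e1' ++ fstK κ' ∷ sndK κ' ∷ e2') (pt' : x ≡ e1' ++ e2') →
        length e1' ≡ suc (length e1) →
        Move (cap {y} {x} e1' κ' e2' ps' pt' ∷ [ cup {x} {y} e1 κ e2 ps pt ]) [ idFT ]
  T5b : ∀ {x y} (e1 e2 e1' e2' : OWord) (κ κ' : Kappa)
        (ps : x ≡ e1 ++ e2) (pt : y ≡ e1 ++ fstK κ ∷ sndK κ ∷ e2)
        (ps' : y ≡ e1' ++ fstK κ' ∷ sndK κ' ∷ e2') (pt' : x ≡ e1' ++ e2') →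
        suc (length e1') ≡ length e1 →
        Move (cap {y} {x} e1' κ' e2' ps' pt' ∷ [ cup {x} {y} e1 κ e2 ps pt ]) [ idFT ]
  T6c : ∀ {x y z} (e1 e2 : OWord) (κ κ' : Kappa)
        (ps : x ≡ e1 ++ e2) (pt : y ≡ e1 ++ fstK κ ∷ sndK κ ∷ e2)
        (ps' : x ≡ e1 ++ e2) (pt' : z ≡ e1 ++ fstK κ' ∷ sndK κ' ∷ e2)
        (c : PZ) (r1 : 1 ≤ suc (length e1)) (r2 : suc (length e1) < length y) →
        Move (braid {y} {z} (σPow (length y) (suc (length e1)) r1 r2 c) ∷ [ cup {x} {y} e1 κ e2 ps pt ])
             [ cup {x} {z} e1 κ' e2 ps' pt' ]
  T6a : ∀ {x y z} (e1 e2 : OWord) (κ κ' : Kappa)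
        (ps : y ≡ e1 ++ fstK κ ∷ sndK κ ∷ e2) (pt : z ≡ e1 ++ e2)
        (ps' : x ≡ e1 ++ fstK κ' ∷ sndK κ' ∷ e2) (pt' : z ≡ e1 ++ e2)
        (c : PZ) (r1 : 1 ≤ suc (length e1)) (r2 : suc (length e1) < length x) →
        Move (cap {y} {z} e1 κ e2 ps pt ∷ [ braid {x} {y} (σPow (length x) (suc (length e1)) r1 r2 c) ])
             [ cap {x} {z} e1 κ' e2 ps' pt' ]

data _≃_ {a b : OWord} : Tangle a b → Tangle a b → Set₁ where
  ≃-refl  : ∀ {T} → T ≃ T
  ≃-sym   : ∀ {T U} → T ≃ U → U ≃ T
  ≃-trans : ∀ {T U V} → T ≃ U → U ≃ V → T ≃ V
  ≃-step  : ∀ {x y} (X : Path y b) (Y : Path a x) {L R : Tangle x y} → Move L R →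
            WF (X ▹ (L ◃ Y)) → WF (X ▹ (R ◃ Y)) →
            (X ▹ (L ◃ Y)) ≃ (X ▹ (R ◃ Y))

capL↑ : FT (down ∷ up ∷ down ∷ []) (down ∷ [])
capL↑ = cap [] du (down ∷ []) refl refl
cupR↑ : FT (down ∷ []) (down ∷ up ∷ down ∷ [])
cupR↑ = cup (down ∷ []) ud [] refl refl
capR↑ : FT (down ∷ up ∷ down ∷ []) (down ∷ [])
capR↑ = cap (down ∷ []) ud [] refl refl
cupL↑ : FT (down ∷ []) (down ∷ up ∷ down ∷ [])
cupL↑ = cup [] du (down ∷ []) refl refl

transpose↑ : Tangle (up ∷ []) (up ∷ []) → Tangle (down ∷ []) (down ∷ [])
transpose↑ T = [ capL↑ ] · (tens (down ∷ []) (down ∷ []) T · [ cupR↑ ])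

transpose↑' : Tangle (up ∷ []) (up ∷ []) → Tangle (down ∷ []) (down ∷ [])
transpose↑' T = [ capR↑ ] · (tens (down ∷ []) (down ∷ []) T · [ cupL↑ ])

capL↓ : FT (up ∷ down ∷ up ∷ []) (up ∷ [])
capL↓ = cap [] ud (up ∷ []) refl refl
cupR↓ : FT (up ∷ []) (up ∷ down ∷ up ∷ [])
cupR↓ = cup (up ∷ []) du [] refl refl
capR↓ : FT (up ∷ down ∷ up ∷ []) (up ∷ [])
capR↓ = cap (up ∷ []) du [] refl refl
cupL↓ : FT (up ∷ []) (up ∷ down ∷ up ∷ [])
cupL↓ = cup [] ud (up ∷ []) refl refl

transpose↓ : Tangle (down ∷ []) (down ∷ []) → Tangle (up ∷ []) (up ∷ [])
transpose↓ T = [ capL↓ ] · (tens (up ∷ []) (up ∷ []) T · [ cupR↓ ])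

transpose↓' : Tangle (down ∷ []) (down ∷ []) → Tangle (up ∷ []) (up ∷ [])
transpose↓' T = [ capR↓ ] · (tens (up ∷ []) (up ∷ []) T · [ cupL↓ ])

-- The transpose is deformed into its mirror image without ever cutting the strand of T.
-- Pulling the right cup across that strand (T4, the cup riding on a strand cabled in two)
-- replaces it by the crossing σ₁σ₂ above a cup on the left, and T slides through this crossing
-- (T4).  The cap absorbs σ₁ (T6) and, pulled back across the strand (T4 with a cap), becomes the
-- right cap above σ₁⁻¹σ₂⁻¹σ₂ = σ₁⁻¹; T slides back through σ₁⁻¹, which the cup finally absorbs
-- (T6).  The side conditions of T4 on profinite braids are certified in explicit finite
-- quotients: b(k) is computed in the symmetric group S₃, and the 2-cabling of a strand of a
-- 2-braid factors, for every finite quotient H of B₃, through the wreath product H ≀ ℤ/2.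

module Submission where

open import Defs
open import Level using (0ℓ; lift; lower) renaming (suc to lsuc)
import Algebra.Construct.Terminal as Terminal
open import Algebra.Bundles using (Group)
open import Algebra.Morphism.Structures using (IsGroupHomomorphism)
import Algebra.Properties.Group as GroupProperties
open import Data.Bool using (Bool; true; false; if_then_else_; _∧_; _xor_; not)
open import Data.Bool.Properties using (T-∧; T-≡; xor-assoc; xor-comm; xor-same; xor-identityʳ; not-distribʳ-xor)
open import Data.Empty using (⊥; ⊥-elim)
open import Data.List using (List; []; _∷_; _++_; length; reverse; upTo; applyUpTo; map; concatMap)
open import Data.List.Properties using (length-++; ++-assoc; ++-identityʳ; unfold-reverse; reverse-involutive)
open import Data.List.Membership.Propositional using (find)
open import Data.List.Membership.Propositional.Properties using (∈-upTo⁺; ∈-applyUpTo⁺)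
open import Data.List.Relation.Unary.All as All using (All; []; _∷_; all?)
open import Data.List.Relation.Unary.Any as Any using (Any; here; there; any?)
open import Data.List.Relation.Unary.Any.Properties using (concatMap⁺)
open import Data.Nat using (ℕ; zero; suc; _+_; _∸_; _≤_; _<_; z≤n; s≤s; _≡ᵇ_; _<ᵇ_; _≤ᵇ_; _≟_; _≤?_)
open import Data.Nat.Properties using (≡ᵇ⇒≡; ≡⇒≡ᵇ; <ᵇ⇒<; <⇒<ᵇ; ≤⇒≤ᵇ; ≤-trans; <-irrefl; ≰⇒>; <-trans; +-monoˡ-≤; +-identityʳ; m+n∸n≡m; m≤m+n; m≤n+m; +-monoʳ-<; m<m+n; n≤1+n; m+n∸m≡n; m<n⇒0<n∸m; m≤n+o⇒m∸n≤o; m+[n∸m]≡n; <⇒≤; m∸n≢0⇒n<m; ≤-refl)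
open import Data.Maybe using (just)
open import Data.Product using (Σ; _×_; _,_; proj₁; proj₂)
open import Data.Unit.Polymorphic using (tt)
open import Function using (Equivalence)
open import Relation.Nullary using (Dec; yes; no; ¬_)
open import Relation.Nullary.Decidable using (map′; toWitness)
open import Relation.Binary.Bundles using (Setoid)
import Relation.Binary.Reasoning.Setoid as SetoidReasoning
open import Relation.Binary.PropositionalEquality

module Quotient {n} (q : FQ n) = Group (FinGroup.grp (FQ.G q))

≡ᵇ-refl : ∀ n → (n ≡ᵇ n) ≡ true
≡ᵇ-refl n = Equivalence.to T-≡ (≡⇒≡ᵇ n n refl)

1+n≡ᵇn : ∀ n → (suc n ≡ᵇ n) ≡ false
1+n≡ᵇn zero    = refl
1+n≡ᵇn (suc n) = 1+n≡ᵇn n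

≡ᵇ-true⇒≡ : ∀ {m n} → (m ≡ᵇ n) ≡ true → m ≡ n
≡ᵇ-true⇒≡ {m} {n} eq = ≡ᵇ⇒≡ m n (Equivalence.from T-≡ eq)

swap-involutive : ∀ i k → swap i (swap i k) ≡ k
swap-involutive i k with k ≡ᵇ i in k≡i
... | true with refl ← ≡ᵇ-true⇒≡ {k} {i} k≡i rewrite 1+n≡ᵇn i | ≡ᵇ-refl i = refl
... | false with k ≡ᵇ suc i in k≡1+i
...   | true with refl ← ≡ᵇ-true⇒≡ {k} {suc i} k≡1+i rewrite ≡ᵇ-refl i = refl
...   | false rewrite k≡i | k≡1+i = refl

swap-fixes : ∀ {i k} → k ≢ i → k ≢ suc i → swap i k ≡ k
swap-fixes {i} {k} k≢i k≢1+i with k ≡ᵇ i in k≡i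
... | true = ⊥-elim (k≢i (≡ᵇ-true⇒≡ k≡i))
... | false with k ≡ᵇ suc i in k≡1+i
...   | true = ⊥-elim (k≢1+i (≡ᵇ-true⇒≡ k≡1+i))
...   | false = refl

swap-suc : ∀ j x → swap (suc j) (suc x) ≡ suc (swap j x)
swap-suc j x with x ≡ᵇ j
... | true  = refl
... | false with x ≡ᵇ suc j
...   | true  = refl
...   | false = refl

swap-+ : ∀ m j x → swap (m + j) (m + x) ≡ m + swap j x
swap-+ zero    j x = refl
swap-+ (suc m) j x = trans (swap-suc (m + j) (m + x)) (cong suc (swap-+ m j x))

eval-++ : ∀ {n} (q : FQ n) v w → Eq (FQ.G q) (eval q (v ++ w)) (mul (FQ.G q) (eval q v) (eval q w))
eval-++ q []                w = Quotient.sym q (Quotient.identityˡ q _)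
eval-++ q ((_ , false) ∷ v) w =
  Quotient.trans q (Quotient.∙-congˡ q (eval-++ q v w)) (Quotient.sym q (Quotient.assoc q _ _ _))
eval-++ q ((_ , true)  ∷ v) w =
  Quotient.trans q (Quotient.∙-congˡ q (eval-++ q v w)) (Quotient.sym q (Quotient.assoc q _ _ _))

permw-fixes-above : ∀ {n} w {i} → ValidWord n w → n < i → permw w i ≡ i
permw-fixes-above []            []                n<i = refl
permw-fixes-above ((j , _) ∷ w) ((_ , j<n) ∷ vs) n<i rewrite permw-fixes-above w vs n<i =
  swap-fixes (λ i≡j → <-irrefl (sym i≡j) (<-trans j<n n<i))
             (λ i≡1+j → <-irrefl (sym i≡1+j) (≤-trans (s≤s j<n) n<i))

valid-weaken : ∀ {n} m w → ValidWord n w → ValidWord (n + m) w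
valid-weaken {n} m w = All.map (λ (1≤i , i<n) → 1≤i , ≤-trans i<n (m≤m+n n m))

eval-restrictR : ∀ {n} m (q : FQ (n + m)) w → eval q w ≡ eval (restrictR m q) w
eval-restrictR m q []                = refl
eval-restrictR m q ((j , false) ∷ w) = cong (mul (FQ.G q) (FQ.gen q j)) (eval-restrictR m q w)
eval-restrictR m q ((j , true)  ∷ w) = cong (mul (FQ.G q) (inv (FQ.G q) (FQ.gen q j))) (eval-restrictR m q w)

shiftWord : ℕ → Word → Word
shiftWord m = map (λ (j , s) → m + j , s)

valid-shiftWord : ∀ {n} m w → ValidWord n w → ValidWord (m + n) (shiftWord m w)
valid-shiftWord m []            []                   = []
valid-shiftWord m ((j , _) ∷ w) ((1≤j , j<n) ∷ vs) =
  (≤-trans 1≤j (m≤n+m j m) , +-monoʳ-< m j<n) ∷ valid-shiftWord m w vs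

eval-shiftWord : ∀ m {n} (q : FQ (m + n)) w → eval q (shiftWord m w) ≡ eval (restrictL m q) w
eval-shiftWord m q []                = refl
eval-shiftWord m q ((j , false) ∷ w) = cong (mul (FQ.G q) (FQ.gen q (m + j))) (eval-shiftWord m q w)
eval-shiftWord m q ((j , true)  ∷ w) = cong (mul (FQ.G q) (inv (FQ.G q) (FQ.gen q (m + j)))) (eval-shiftWord m q w)

permw-shiftWord : ∀ m w x → permw (shiftWord m w) (m + x) ≡ m + permw w x
permw-shiftWord m []            x = refl
permw-shiftWord m ((j , _) ∷ w) x rewrite permw-shiftWord m w x = swap-+ m j (permw w x)

permw-shiftWord-fixes-below : ∀ {n} m w {i} → ValidWord n w → i ≤ m → permw (shiftWord m w) i ≡ i
permw-shiftWord-fixes-below m []            []                  i≤m = refl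
permw-shiftWord-fixes-below m ((j , _) ∷ w) ((1≤j , _) ∷ vs) i≤m
  rewrite permw-shiftWord-fixes-below m w vs i≤m =
  swap-fixes (λ i≡m+j → <-irrefl i≡m+j (≤-trans (s≤s i≤m) m<m+j))
             (λ i≡1+m+j → <-irrefl i≡1+m+j (≤-trans (s≤s i≤m) (≤-trans m<m+j (n≤1+n _))))
  where m<m+j = m<m+n m 1≤j

trivialFinGroup : FinGroup
trivialFinGroup = record { grp = Terminal.group ; enum = tt ∷ [] ; complete = λ _ → here _ }

trivialQuotient : ∀ n → FQ n
trivialQuotient n = record
  { G = trivialFinGroup ; gen = λ _ → tt ; far = λ _ _ _ _ _ → _ ; brd = λ _ _ _ → _ }

trivialHom : (G : FinGroup) → Hom trivialFinGroup G
trivialHom G = (λ _ → Group.ε g) , record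
  { isMonoidHomomorphism = record
    { isMagmaHomomorphism = record
      { isRelHomomorphism = record { cong = λ _ → Group.refl g }
      ; homo = λ _ _ → Group.sym g (Group.identityˡ g (Group.ε g)) }
    ; ε-homo = Group.refl g }
  ; ⁻¹-homo = λ _ → Group.sym g (GroupProperties.ε⁻¹≈ε g) }
  where g = FinGroup.grp G

braid₀≈unit : (b : PBraid 0) (q : FQ 0) → Eq (FQ.G q) (one (FQ.G q)) (at b q)
braid₀≈unit b q = natural b (trivialQuotient 0) q (trivialHom (FQ.G q)) (λ _ _ ())

isGenerator : ℕ → ℕ → Bool
isGenerator n i = (1 ≤ᵇ i) ∧ (i <ᵇ n)

isGenerator⇒< : ∀ {n i} → isGenerator n i ≡ true → i < n
isGenerator⇒< {n} {i} eq = <ᵇ⇒< i n (proj₂ (Equivalence.to T-∧ (Equivalence.from T-≡ eq)))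

valid⇒isGenerator : ∀ {n i} → 1 ≤ i × i < n → isGenerator n i ≡ true
valid⇒isGenerator (1≤i , i<n) = Equivalence.to T-≡ (Equivalence.from T-∧ (≤⇒≤ᵇ 1≤i , <⇒<ᵇ i<n))

-- The letters σ_i with 1 ≤ i < n act by the transposition (i i+1), all others trivially,
-- so that every word denotes an element of S_n.
act : ℕ → Word → ℕ → ℕ
act n []            k = k
act n ((i , _) ∷ w) k = if isGenerator n i then swap i (act n w k) else act n w k

act-++ : ∀ n v w k → act n (v ++ w) k ≡ act n v (act n w k)
act-++ n []            w k = refl
act-++ n ((i , _) ∷ v) w k rewrite act-++ n v w k = refl

act-letter-involutive : ∀ n x k → act n (x ∷ []) (act n (x ∷ []) k) ≡ k
act-letter-involutive n (i , _) k with isGenerator n i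
... | true  = swap-involutive i k
... | false = refl

act-reverse-inverseˡ : ∀ n w k → act n (reverse w) (act n w k) ≡ k
act-reverse-inverseˡ n []      k = refl
act-reverse-inverseˡ n (x ∷ w) k = begin
  act n (reverse (x ∷ w)) (act n (x ∷ w) k)          ≡⟨ cong (λ v → act n v (act n (x ∷ w) k)) (unfold-reverse x w) ⟩
  act n (reverse w ++ x ∷ []) (act n (x ∷ w) k)      ≡⟨ act-++ n (reverse w) (x ∷ []) _ ⟩
  act n (reverse w) (act n (x ∷ []) (act n (x ∷ w) k)) ≡⟨ cong (act n (reverse w)) (act-letter-involutive n x (act n w k)) ⟩
  act n (reverse w) (act n w k)                      ≡⟨ act-reverse-inverseˡ n w k ⟩
  k                                                  ∎
  where open ≡-Reasoning

act-reverse-inverseʳ : ∀ n w k → act n w (act n (reverse w) k) ≡ k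
act-reverse-inverseʳ n w k =
  trans (cong (λ v → act n v (act n (reverse w) k)) (sym (reverse-involutive w)))
        (act-reverse-inverseˡ n (reverse w) k)

SameAction : ℕ → Word → Word → Set
SameAction n v w = ∀ k → act n v k ≡ act n w k

symGroup : ℕ → Group 0ℓ 0ℓ
symGroup n = record
  { Carrier = Word ; _≈_ = SameAction n ; _∙_ = _++_ ; ε = [] ; _⁻¹ = reverse
  ; isGroup = record
    { isMonoid = record
      { isSemigroup = record
        { isMagma = record
          { isEquivalence = record
            { refl = λ _ → refl ; sym = λ p k → sym (p k) ; trans = λ p q k → trans (p k) (q k) }
          ; ∙-cong = λ {v} {v'} {w} {w'} p q k →
              trans (act-++ n v w k) (trans (cong (act n v) (q k))
                    (trans (p (act n w' k)) (sym (act-++ n v' w' k)))) }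
        ; assoc = λ u v w k → cong (λ x → act n x k) (++-assoc u v w) }
      ; identity = (λ _ _ → refl) , (λ w k → cong (λ x → act n x k) (++-identityʳ w)) }
    ; inverse = (λ w k → trans (act-++ n (reverse w) w k) (act-reverse-inverseˡ n w k))
              , (λ w k → trans (act-++ n w (reverse w) k) (act-reverse-inverseʳ n w k))
    ; ⁻¹-cong = λ {v} {w} p k → begin
        act n (reverse v) k                                   ≡⟨ cong (act n (reverse v)) (sym (act-reverse-inverseʳ n w k)) ⟩
        act n (reverse v) (act n w (act n (reverse w) k))     ≡⟨ cong (act n (reverse v)) (sym (p _)) ⟩
        act n (reverse v) (act n v (act n (reverse w) k))     ≡⟨ act-reverse-inverseˡ n v _ ⟩
        act n (reverse w) k                                   ∎ } }
  where open ≡-Reasoning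

act-fixes-above : ∀ n w {k} → n < k → act n w k ≡ k
act-fixes-above n []            n<k = refl
act-fixes-above n ((i , _) ∷ w) {k} n<k with isGenerator n i in gen
... | false = act-fixes-above n w n<k
... | true rewrite act-fixes-above n w n<k =
  swap-fixes (λ k≡i → <-irrefl (sym k≡i) (<-trans i<n n<k))
             (λ k≡1+i → <-irrefl (sym k≡1+i) (≤-trans (s≤s i<n) n<k))
  where i<n = isGenerator⇒< gen

sameAction? : ∀ n v w → Dec (SameAction n v w)
sameAction? n v w =
  map′ fromBelow (λ p → All.tabulate (λ {k} _ → p k)) (all? (λ k → act n v k ≟ act n w k) (upTo (suc n)))
  where
  fromBelow : All (λ k → act n v k ≡ act n w k) (upTo (suc n)) → SameAction n v w
  fromBelow agree k with k ≤? n
  ... | yes k≤n = All.lookup agree (∈-upTo⁺ (s≤s k≤n))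
  ... | no  k≰n = trans (act-fixes-above n v (≰⇒> k≰n)) (sym (act-fixes-above n w (≰⇒> k≰n)))

no-far-generators : ∀ {n i j} → n ≤ 3 → 1 ≤ i → i + 2 ≤ j → j < n → ⊥
no-far-generators n≤3 1≤i i+2≤j j<n =
  <-irrefl refl (≤-trans (s≤s (≤-trans (+-monoˡ-≤ 2 1≤i) i+2≤j)) (≤-trans j<n n≤3))

ClosedUnderGenerators : ℕ → List Word → Set
ClosedUnderGenerators n E = All (λ e → All (λ i → Any (SameAction n ((i , false) ∷ e)) E) (upTo n)) E

closedUnderGenerators? : ∀ n E → Dec (ClosedUnderGenerators n E)
closedUnderGenerators? n E = all? (λ e → all? (λ i → any? (sameAction? n ((i , false) ∷ e)) E) (upTo n)) E

enumerates : ∀ n E → Any (SameAction n []) E → ClosedUnderGenerators n E → ∀ w → Any (SameAction n w) E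
enumerates n E hasUnit closed []            = hasUnit
enumerates n E hasUnit closed ((i , _) ∷ w) with isGenerator n i in gen
... | false = enumerates n E hasUnit closed w
... | true  with find (enumerates n E hasUnit closed w)
...   | e , e∈E , w∼e =
  Any.map (λ σe∼e' k → trans (cong (swap i) (w∼e k))
                             (trans (cong (λ b → if b then swap i (act n e k) else act n e k) (sym gen))
                                    (σe∼e' k)))
          (All.lookup (All.lookup closed e∈E) (∈-upTo⁺ (isGenerator⇒< gen)))

sym₃Elements : List Word
sym₃Elements = map (map (_, false))
  ([] ∷ (1 ∷ []) ∷ (2 ∷ []) ∷ (1 ∷ 2 ∷ []) ∷ (2 ∷ 1 ∷ []) ∷ (1 ∷ 2 ∷ 1 ∷ []) ∷ [])

sym₃ : FinGroup
sym₃ = record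
  { grp      = symGroup 3
  ; enum     = sym₃Elements
  ; complete = enumerates 3 sym₃Elements (here (λ _ → refl))
                 (toWitness {a? = closedUnderGenerators? 3 sym₃Elements} _) }

symQuotient : ∀ {m} → m ≤ 3 → FQ m
symQuotient m≤3 = record
  { G   = sym₃
  ; gen = λ i → (i , false) ∷ []
  ; far = λ _ _ 1≤i i+2≤j j<m → ⊥-elim (no-far-generators m≤3 1≤i i+2≤j j<m)
  ; brd = braid-relation }
  where
  braid-relation : ∀ i → 1 ≤ i → suc i < _ → SameAction 3 ((i , false) ∷ (suc i , false) ∷ (i , false) ∷ [])
                                                           ((suc i , false) ∷ (i , false) ∷ (suc i , false) ∷ [])
  braid-relation 1 _ _ =
    toWitness {a? = sameAction? 3 ((1 , false) ∷ (2 , false) ∷ (1 , false) ∷ [])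
                                  ((2 , false) ∷ (1 , false) ∷ (2 , false) ∷ [])} _
  braid-relation (suc (suc i)) _ 3+i<m with ≤-trans 3+i<m m≤3
  ... | s≤s (s≤s (s≤s ()))

act-eval-symQuotient : ∀ {m} (m≤3 : m ≤ 3) w → ValidWord m w →
                       ∀ k → act 3 (eval (symQuotient m≤3) w) k ≡ permw w k
act-eval-symQuotient m≤3 []             []                  k = refl
act-eval-symQuotient m≤3 ((i , false) ∷ w) ((1≤i , i<m) ∷ vs) k
  rewrite valid⇒isGenerator (1≤i , ≤-trans i<m m≤3) = cong (swap i) (act-eval-symQuotient m≤3 w vs k)
act-eval-symQuotient m≤3 ((i , true)  ∷ w) ((1≤i , i<m) ∷ vs) k
  rewrite valid⇒isGenerator (1≤i , ≤-trans i<m m≤3) = cong (swap i) (act-eval-symQuotient m≤3 w vs k)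

perm-symQuotient : ∀ {m} (m≤3 : m ≤ 3) (b : PBraid m) k → Perm b k (act 3 (at b (symQuotient m≤3)) k)
perm-symQuotient m≤3 b k = symQuotient m≤3 , λ w valid w≈b →
  trans (sym (act-eval-symQuotient m≤3 w valid k)) (w≈b k)

oneẐ : PZ
atZ      oneẐ q         = proj₂ q
naturalZ oneẐ _ _ _ f≈ = f≈

minusOneẐ : PZ
atZ      minusOneẐ q = inv (proj₁ q) (proj₂ q)
naturalZ minusOneẐ q q' f f≈ =
  Group.trans (FinGroup.grp (proj₁ q'))
    (IsGroupHomomorphism.⁻¹-homo (proj₂ f) (proj₂ q)) (Group.⁻¹-cong (FinGroup.grp (proj₁ q')) f≈)

σ₁ σ₁⁻¹ : ∀ {n} → PBraid (2 + n)
σ₁   = σPow _ 1 (s≤s z≤n) (s≤s (s≤s z≤n)) oneẐ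
σ₁⁻¹ = σPow _ 1 (s≤s z≤n) (s≤s (s≤s z≤n)) minusOneẐ

σ₂ σ₂⁻¹ : ∀ {n} → PBraid (3 + n)
σ₂   = σPow _ 2 (s≤s z≤n) (s≤s (s≤s (s≤s z≤n))) oneẐ
σ₂⁻¹ = σPow _ 2 (s≤s z≤n) (s≤s (s≤s (s≤s z≤n))) minusOneẐ

module Wreath (H : FinGroup) where
  open Group (FinGroup.grp H) renaming (Carrier to C; refl to ≈-refl; sym to ≈-sym; trans to ≈-trans)

  -- H ≀ ℤ/2 = (H × H) ⋊ ℤ/2, the factor ℤ/2 exchanging the two copies of H
  Carrier : Set
  Carrier = (Bool → C) × Bool

  _≈W_ : Carrier → Carrier → Set
  (f , a) ≈W (g , b) = (∀ i → f i ≈ g i) × a ≡ b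

  _∙W_ : Carrier → Carrier → Carrier
  (f , a) ∙W (g , b) = (λ i → f (i xor b) ∙ g i) , a xor b

  _⁻¹W : Carrier → Carrier
  (f , a) ⁻¹W = (λ i → f (i xor a) ⁻¹) , a

  private
    ≈-at : ∀ (f : Bool → C) {i j} → i ≡ j → f i ≈ f j
    ≈-at f refl = ≈-refl

    xor-cancelʳ : ∀ i a → (i xor a) xor a ≡ i
    xor-cancelʳ i a = trans (xor-assoc i a a) (trans (cong (i xor_) (xor-same a)) (xor-identityʳ i))

  group : Group 0ℓ 0ℓ
  group = record
    { Carrier = Carrier ; _≈_ = _≈W_ ; _∙_ = _∙W_ ; ε = (λ _ → ε) , false ; _⁻¹ = _⁻¹W
    ; isGroup = record
      { isMonoid = record
        { isSemigroup = record
          { isMagma = record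
            { isEquivalence = record
              { refl  = (λ _ → ≈-refl) , refl
              ; sym   = λ (p , e) → (λ i → ≈-sym (p i)) , sym e
              ; trans = λ (p , e) (q , e') → (λ i → ≈-trans (p i) (q i)) , trans e e' }
            ; ∙-cong = λ { {_} {_} {_ , b} (p , refl) (q , refl) → (λ i → ∙-cong (p (i xor b)) (q i)) , refl } }
          ; assoc = λ (f , a) (g , b) (h , c) →
              (λ i → ≈-trans (assoc _ _ _) (∙-congʳ (≈-at f (trans (xor-assoc i c b) (cong (i xor_) (xor-comm c b))))))
              , xor-assoc a b c }
        ; identity = (λ (f , a) → (λ i → identityˡ (f i)) , refl)
                   , (λ (f , a) → (λ i → ≈-trans (identityʳ _) (≈-at f (xor-identityʳ i))) , xor-identityʳ a) }
      ; inverse = (λ (f , a) → (λ i → ≈-trans (∙-congʳ (⁻¹-cong (≈-at f (xor-cancelʳ i a)))) (inverseˡ (f i))) , xor-same a)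
                , (λ (f , a) → (λ i → inverseʳ (f (i xor a))) , xor-same a)
      ; ⁻¹-cong = λ { {_ , a} (p , refl) → (λ i → ⁻¹-cong (p (i xor a))) , refl } } }

  private
    pair : C → C → Bool → Carrier
    pair x y a = (λ i → if i then y else x) , a

  elements : List Carrier
  elements = concatMap (λ x → concatMap (λ y → pair x y false ∷ pair x y true ∷ []) (FinGroup.enum H))
                       (FinGroup.enum H)

  complete : ∀ w → Any (w ≈W_) elements
  complete (f , a) =
    concatMap⁺ _ (Any.map (λ f₀≈x → concatMap⁺ _ (Any.map (λ f₁≈y → this-pair a f₀≈x f₁≈y)
                                                          (FinGroup.complete H (f true))))
                          (FinGroup.complete H (f false)))
    where
    this-pair : ∀ {x y} b → f false ≈ x → f true ≈ y → Any ((f , b) ≈W_) (pair x y false ∷ pair x y true ∷ [])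
    this-pair false f₀≈x f₁≈y = here  ((λ { false → f₀≈x ; true → f₁≈y }) , refl)
    this-pair true  f₀≈x f₁≈y = there (here ((λ { false → f₀≈x ; true → f₁≈y }) , refl))

  finGroup : FinGroup
  finGroup = record { grp = group ; enum = elements ; complete = complete }

twoStrandQuotient : (G : FinGroup) → Car G → FQ 2
twoStrandQuotient G g = record
  { G = G ; gen = λ _ → g
  ; far = λ _ _ 1≤i i+2≤j j<2 → ⊥-elim (no-far-generators (s≤s (s≤s z≤n)) 1≤i i+2≤j j<2)
  ; brd = λ { _ (s≤s z≤n) (s≤s (s≤s ())) } }

strand : Bool → ℕ
strand false = 1
strand true  = 2

swap₁-strand : ∀ c → swap 1 (strand c) ≡ strand (not c)
swap₁-strand false = refl
swap₁-strand true  = refl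

-- A finite quotient of B₂ through which the 2-cabling of the first strand of a 2-braid factors:
-- the image of a word records, for each of the two bottom positions c, the cabled word seen
-- from c, together with the permutation (in ℤ/2) of the word.
module Doubling (q : FQ 3) where
  open Quotient q
    renaming (Carrier to C; refl to ≈-refl; sym to ≈-sym; trans to ≈-trans; reflexive to ≈-reflexive)
  open Wreath (FQ.G q) using (_∙W_; _⁻¹W; finGroup)

  doubledσ₁ : Wreath.Carrier (FQ.G q)
  doubledσ₁ = (λ c → eval q (cabLetter (strand c) 2 (1 , false))) , true

  quotient : FQ 2
  quotient = twoStrandQuotient finGroup doubledσ₁

  doubled : Bool → Wreath.Carrier (FQ.G q)
  doubled false = doubledσ₁
  doubled true  = doubledσ₁ ⁻¹W

  doubled-odd : ∀ s → proj₂ (doubled s) ≡ true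
  doubled-odd false = refl
  doubled-odd true  = refl

  inverse-of-pair : ∀ a b → (a ∙ (b ∙ ε)) ⁻¹ ≈ b ⁻¹ ∙ (a ⁻¹ ∙ ε)
  inverse-of-pair a b = ≈-trans (⁻¹-cong (∙-congˡ (identityʳ b)))
    (≈-trans (GroupProperties.⁻¹-anti-homo-∙ (FinGroup.grp (FQ.G q)) a b) (∙-congˡ (≈-sym (identityʳ _))))

  doubled-cabLetter : ∀ s c → proj₁ (doubled s) c ≈ eval q (cabLetter (strand c) 2 (1 , s))
  doubled-cabLetter false c     = ≈-refl
  doubled-cabLetter true  false = inverse-of-pair _ _
  doubled-cabLetter true  true  = inverse-of-pair _ _

  CablingInvariant : Word → Wreath.Carrier (FQ.G q) → Set
  CablingInvariant w (f , π) =
    (∀ c → f c ≈ eval q (cabw (strand c) 2 w)) × (∀ c → permw w (strand c) ≡ strand (c xor π))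

  cablingInvariant-∷ : ∀ s w x → CablingInvariant w x → CablingInvariant ((1 , s) ∷ w) (doubled s ∙W x)
  cablingInvariant-∷ s w (f , π) (cabled , moved) =
    (λ c → ≈-trans (∙-cong (doubled-cabLetter s (c xor π)) (cabled c))
             (≈-trans (≈-reflexive (cong (λ p → eval q (cabLetter p 2 (1 , s)) ∙ eval q (cabw (strand c) 2 w))
                                         (sym (moved c))))
                      (≈-sym (eval-++ q (cabLetter (permw w (strand c)) 2 (1 , s)) _))))
    , (λ c → trans (cong (swap 1) (moved c))
               (trans (swap₁-strand (c xor π))
                      (cong strand (trans (not-distribʳ-xor c π)
                                          (cong (λ b → c xor (b xor π)) (sym (doubled-odd s)))))))

  cablingInvariant : ∀ w → ValidWord 2 w → CablingInvariant w (eval quotient w)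
  cablingInvariant []                      []      = (λ _ → ≈-refl) , (λ { false → refl ; true → refl })
  cablingInvariant ((suc zero , false) ∷ w) (_ ∷ vs) = cablingInvariant-∷ false w _ (cablingInvariant w vs)
  cablingInvariant ((suc zero , true)  ∷ w) (_ ∷ vs) = cablingInvariant-∷ true  w _ (cablingInvariant w vs)
  cablingInvariant ((zero , _)          ∷ w) ((() , _) ∷ _)
  cablingInvariant ((suc (suc _) , _)   ∷ w) ((_ , s≤s (s≤s ())) ∷ _)

cab-σ₁ : Cab 1 2 (σ₁ {0}) (σ₁ {1} ·B σ₂ {0})
cab-σ₁ q = Doubling.quotient q , λ w valid w≈σ₁ →
  Quotient.trans q (Quotient.sym q (proj₁ (Doubling.cablingInvariant q w valid) false))
    (Quotient.trans q (proj₁ w≈σ₁ false) (Quotient.∙-congˡ q (Quotient.identityʳ q _)))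

cab-σ₁⁻¹ : Cab 1 2 (σ₁⁻¹ {0}) (σ₁⁻¹ {1} ·B σ₂⁻¹ {0})
cab-σ₁⁻¹ q = Doubling.quotient q , λ w valid w≈σ₁⁻¹ →
  Quotient.trans q (Quotient.sym q (proj₁ (Doubling.cablingInvariant q w valid) false))
    (Quotient.trans q (proj₁ w≈σ₁⁻¹ false)
      (Quotient.trans q (Doubling.inverse-of-pair q _ _) (Quotient.∙-congˡ q (Quotient.identityʳ q _))))

cabLetter-single : ∀ p x → cabLetter p 1 x ≡ x ∷ []
cabLetter-single p (i , s) with p ≡ᵇ i
... | true rewrite +-identityʳ i = refl
... | false with p ≡ᵇ suc i
...   | true rewrite +-identityʳ i = refl
...   | false with p <ᵇ i
...     | true rewrite m+n∸n≡m i 1 = refl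
...     | false = refl

cabw-single : ∀ k w → cabw k 1 w ≡ w
cabw-single k []      = refl
cabw-single k (x ∷ w) rewrite cabLetter-single (permw w k) x = cong (x ∷_) (cabw-single k w)

cab-single : ∀ {n} k (b : PBraid n) → Cab k 1 b b
cab-single k b q = q , λ w _ w≈b →
  Quotient.trans q (Quotient.reflexive q (cong (eval q) (cabw-single k w))) w≈b

permw-strand₂ : ∀ w → ValidWord 2 w → Σ Bool λ c → permw w 1 ≡ strand c
permw-strand₂ []                    []       = false , refl
permw-strand₂ ((suc zero , _) ∷ w) (_ ∷ vs) with permw-strand₂ w vs
... | c , moved = not c , trans (cong (swap 1) moved) (swap₁-strand c)
permw-strand₂ ((zero , _)        ∷ w) ((() , _) ∷ _)
permw-strand₂ ((suc (suc _) , _) ∷ w) ((_ , s≤s (s≤s ())) ∷ _)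

cabw-erase₂ : ∀ w → ValidWord 2 w → cabw 1 0 w ≡ []
cabw-erase₂ []                    []       = refl
cabw-erase₂ ((suc zero , _) ∷ w) (_ ∷ vs) with permw-strand₂ w vs
... | false , moved rewrite moved = cabw-erase₂ w vs
... | true  , moved rewrite moved = cabw-erase₂ w vs
cabw-erase₂ ((zero , _)        ∷ w) ((() , _) ∷ _)
cabw-erase₂ ((suc (suc _) , _) ∷ w) ((_ , s≤s (s≤s ())) ∷ _)

cab-erase₂ : (b : PBraid 2) → Cab {2} {1} 1 0 b unitB
cab-erase₂ b q = trivialQuotient 2 , λ w valid _ →
  Quotient.reflexive q (cong (eval q) (cabw-erase₂ w valid))

!-++ˡ : ∀ (ε x : OWord) {i} → 1 ≤ i → i ≤ length ε → (ε ++ x) ! i ≡ ε ! i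
!-++ˡ (a ∷ ε) x {suc zero}    _ _       = refl
!-++ˡ (a ∷ ε) x {suc (suc i)} _ (s≤s r) = !-++ˡ ε x (s≤s z≤n) r

!-++ʳ : ∀ (ε x : OWord) {i} → length ε < i → (ε ++ x) ! i ≡ x ! (i ∸ length ε)
!-++ʳ []          x _                       = refl
!-++ʳ (a ∷ ε)     x {suc (suc i)} (s≤s r)   = !-++ʳ ε x r
!-++ʳ (a ∷ [])    x {suc zero}    (s≤s ())
!-++ʳ (a ∷ b ∷ ε) x {suc zero}    (s≤s ())

!-just⇒inRange : ∀ (t : OWord) {j x} → t ! j ≡ just x → 1 ≤ j × j ≤ length t
!-just⇒inRange (a ∷ t) {suc zero}    _  = s≤s z≤n , s≤s z≤n
!-just⇒inRange (a ∷ t) {suc (suc j)} eq = s≤s z≤n , s≤s (proj₂ (!-just⇒inRange t eq))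

!-inRange⇒just : ∀ (s : OWord) {i} → 1 ≤ i → i ≤ length s → Σ Ori λ x → s ! i ≡ just x
!-inRange⇒just (a ∷ s) {suc zero}    _ _       = a , refl
!-inRange⇒just (a ∷ s) {suc (suc i)} _ (s≤s r) = !-inRange⇒just s (s≤s z≤n) r

!-++ˡ-just : ∀ (t ε : OWord) {k x} → t ! k ≡ just x → (t ++ ε) ! k ≡ just x
!-++ˡ-just t ε eq = trans (!-++ˡ t ε (proj₁ (!-just⇒inRange t eq)) (proj₂ (!-just⇒inRange t eq))) eq

-- Whether b is represented by a word in q is undecidable, but a well-formed (b , s) cannot
-- fail to be: otherwise Perm b 1 0 would hold vacuously and force t ! 0 ≡ s ! 1.
wf-braid-represented : ∀ {s t} {b : PBraid (length s)} → WFft (braid {s} {t} b) → (q : FQ (length s)) →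
                       ¬ (∀ w → ValidWord (length s) w → Eq (FQ.G q) (eval q w) (at b q) → ⊥)
wf-braid-represented {[]} {b = b} _ q unrepresented = unrepresented [] [] (braid₀≈unit b q)
wf-braid-represented {_ ∷ _} {[]}    (_ , wf) q unrepresented
  with () ← lower (wf 1 0 (s≤s z≤n) (s≤s z≤n) (q , λ w v e → ⊥-elim (unrepresented w v e)))
wf-braid-represented {_ ∷ _} {_ ∷ _} (_ , wf) q unrepresented
  with () ← lower (wf 1 0 (s≤s z≤n) (s≤s z≤n) (q , λ w v e → ⊥-elim (unrepresented w v e)))

from-representing-words : ∀ {s t} {b : PBraid (length s)} → WFft (braid {s} {t} b) → (q : FQ (length s)) →
                          {A : Set} → Dec A → (∀ w → ValidWord (length s) w → Eq (FQ.G q) (eval q w) (at b q) → A) → A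
from-representing-words wfb q (yes a) _ = a
from-representing-words {s} {t} {b} wfb q (no ¬a) by-rep =
  ⊥-elim (wf-braid-represented {s} {t} {b} wfb q λ w v e → ¬a (by-rep w v e))

perm-fixes-above : ∀ {s t} {b : PBraid (length s)} → WFft (braid {s} {t} b) →
                   ∀ {i k'} → Perm b i k' → length s < i → k' ≡ i
perm-fixes-above {s} {t} {b} wfb {i} {k'} (q , moves) n<i =
  from-representing-words {s} {t} {b} wfb q (k' ≟ i) λ w v e → trans (sym (moves w v e)) (permw-fixes-above w v n<i)

perm-shiftR⁻ : ∀ {n} m (b : PBraid n) {i k'} → Perm (shiftR m b) i k' → Perm b i k'
perm-shiftR⁻ m b (q , moves) = restrictR m q , λ w v e →
  moves w (valid-weaken m w v) (subst (λ x → Eq (FQ.G q) x (at b (restrictR m q))) (sym (eval-restrictR m q w)) e)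

shiftWord-represents : ∀ m {n} (b : PBraid n) (q : FQ (m + n)) w →
                       Eq (FQ.G q) (eval (restrictL m q) w) (at b (restrictL m q)) →
                       Eq (FQ.G q) (eval q (shiftWord m w)) (at (shiftL m b) q)
shiftWord-represents m b q w = subst (λ x → Eq (FQ.G q) x (at b (restrictL m q))) (sym (eval-shiftWord m q w))

perm-shiftL⁻ : ∀ m {n} (b : PBraid n) {i k'} → Perm (shiftL m b) (m + i) k' → Perm b i (k' ∸ m)
perm-shiftL⁻ m b {i} (q , moves) = restrictL m q , λ w v e →
  trans (sym (m+n∸m≡n m (permw w i)))
        (cong (_∸ m) (trans (sym (permw-shiftWord m w i))
                            (moves (shiftWord m w) (valid-shiftWord m w v) (shiftWord-represents m b q w e))))

perm-shiftL-fixes-below : ∀ {s t} {b : PBraid (length s)} → WFft (braid {s} {t} b) →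
                          ∀ m {i k'} → Perm (shiftL m b) i k' → i ≤ m → k' ≡ i
perm-shiftL-fixes-below {s} {t} {b} wfb m {i} {k'} (q , moves) i≤m =
  from-representing-words {s} {t} {b} wfb (restrictL m q) (k' ≟ i) λ w v e →
    trans (sym (moves (shiftWord m w) (valid-shiftWord m w v) (shiftWord-represents m b q w e)))
          (permw-shiftWord-fixes-below m w v i≤m)

wf-lookup-shiftR : ∀ {s t} (b : PBraid (length s)) → WFft (braid {s} {t} b) → ∀ ε {i k'} → 1 ≤ i →
                   Perm (shiftR (length ε) b) i k' → (t ++ ε) ! k' ≡ (s ++ ε) ! i
wf-lookup-shiftR {s} {t} b wfb@(lift |t|≡|s| , wf) ε {i} {k'} 1≤i p with i ≤? length s
... | yes i≤n =
  let x , sᵢ≡x = !-inRange⇒just s 1≤i i≤n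
  in trans (!-++ˡ-just t ε (trans (lower (wf i k' 1≤i i≤n (perm-shiftR⁻ (length ε) b p))) sᵢ≡x))
           (sym (trans (!-++ˡ s ε 1≤i i≤n) sᵢ≡x))
... | no i≰n with refl ← perm-fixes-above {s} {t} {b} wfb (perm-shiftR⁻ (length ε) b p) (≰⇒> i≰n) =
  trans (!-++ʳ t ε (subst (_< i) (sym |t|≡|s|) (≰⇒> i≰n)))
        (trans (cong (λ n → ε ! (i ∸ n)) |t|≡|s|) (sym (!-++ʳ s ε (≰⇒> i≰n))))

wf-lookup-shiftL : ∀ {s t} (b : PBraid (length s)) → WFft (braid {s} {t} b) → ∀ ε {i k'} → 1 ≤ i →
                   i ≤ length ε + length s → Perm (shiftL (length ε) b) i k' → (ε ++ t) ! k' ≡ (ε ++ s) ! i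
wf-lookup-shiftL {s} {t} b wfb ε {i} {k'} 1≤i i≤m+n p with i ≤? length ε
... | yes i≤m with refl ← perm-shiftL-fixes-below {s} {t} {b} wfb (length ε) p i≤m =
  trans (!-++ˡ ε t 1≤i i≤m) (sym (!-++ˡ ε s 1≤i i≤m))
... | no i≰m =
  let m = length ε
      m<i = ≰⇒> i≰m
      i₀ = i ∸ m
      1≤i₀ = m<n⇒0<n∸m m<i
      i₀≤n = m≤n+o⇒m∸n≤o i m i≤m+n
      x , sᵢ₀≡x = !-inRange⇒just s 1≤i₀ i₀≤n
      p₀ = perm-shiftL⁻ m b (subst (λ j → Perm (shiftL m b) j k') (sym (m+[n∸m]≡n (<⇒≤ m<i))) p)
      tₖ≡x = trans (lower (proj₂ wfb i₀ (k' ∸ m) 1≤i₀ i₀≤n p₀)) sᵢ₀≡x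
      m<k' = m∸n≢0⇒n<m λ k'∸m≡0 → <-irrefl refl (subst (1 ≤_) k'∸m≡0 (proj₁ (!-just⇒inRange t tₖ≡x)))
  in trans (!-++ʳ ε t m<k') (trans tₖ≡x (sym (trans (!-++ʳ ε s m<i) sᵢ₀≡x)))

perm-subst : ∀ {m n} (e : m ≡ n) (b : PBraid m) {i k'} → Perm (subst PBraid e b) i k' → Perm b i k'
perm-subst refl b p = p

wfft-ftR : ∀ {s t} ε (γ : FT s t) → WFft γ → WFft (ftR ε γ)
wfft-ftR ε (cap _ _ _ _ _) wf = wf
wfft-ftR ε (cup _ _ _ _ _) wf = wf
wfft-ftR {s} {t} ε (braid b) wfb@(lift |t|≡|s| , _) =
  lift (trans (length-++ t) (trans (cong (_+ length ε) |t|≡|s|) (sym (length-++ s))))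
  , λ i k' 1≤i _ p → lift (wf-lookup-shiftR {s} {t} b wfb ε 1≤i (perm-subst (sym (length-++ s)) (shiftR (length ε) b) p))

wfft-ftL : ∀ {s t} ε (γ : FT s t) → WFft γ → WFft (ftL ε γ)
wfft-ftL ε (cap _ _ _ _ _) wf = wf
wfft-ftL ε (cup _ _ _ _ _) wf = wf
wfft-ftL {s} {t} ε (braid b) wfb@(lift |t|≡|s| , _) =
  lift (trans (length-++ ε) (trans (cong (length ε +_) |t|≡|s|) (sym (length-++ ε))))
  , λ i k' 1≤i i≤m+n p → lift (wf-lookup-shiftL {s} {t} b wfb ε 1≤i (subst (i ≤_) (length-++ ε) i≤m+n)
                                  (perm-subst (sym (length-++ ε)) (shiftL (length ε) b) p))

wf-tR : ∀ {s t} ε (T : Tangle s t) → WF T → WF (tR ε T)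
wf-tR ε [ γ ]   wf         = wfft-ftR ε γ wf
wf-tR ε (γ ∷ T) (wfγ , wf) = wfft-ftR ε γ wfγ , wf-tR ε T wf

wf-tL : ∀ {s t} ε (T : Tangle s t) → WF T → WF (tL ε T)
wf-tL ε [ γ ]   wf         = wfft-ftL ε γ wf
wf-tL ε (γ ∷ T) (wfγ , wf) = wfft-ftL ε γ wfγ , wf-tL ε T wf

wf-tens : ∀ {s t} ε₁ ε₂ (T : Tangle s t) → WF T → WF (tens ε₁ ε₂ T)
wf-tens ε₁ ε₂ T wf = wf-tL ε₁ (tR ε₂ T) (wf-tR ε₂ T wf)

wf-· : ∀ {a b c} (T : Tangle b c) (U : Tangle a b) → WF T → WF U → WF (T · U)
wf-· [ γ ]   U wfγ        wfU = wfγ , wfU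
wf-· (γ ∷ T) U (wfγ , wf) wfU = wfγ , wf-· T U wf wfU

inRange-by-list : ∀ {n} (P : ℕ → Set) → All P (applyUpTo suc n) → ∀ i → 1 ≤ i → i ≤ n → P i
inRange-by-list P all (suc i) _ i<n = All.lookup all (∈-applyUpTo⁺ suc i<n)

wf-braid-by-word : ∀ {s t} (b : PBraid (length s)) w → ValidWord (length s) w →
                   (∀ q → Eq (FQ.G q) (eval q w) (at b q)) → length t ≡ length s →
                   (∀ i → 1 ≤ i → i ≤ length s → t ! permw w i ≡ s ! i) → WFft (braid {s} {t} b)
wf-braid-by-word {s} {t} b w valid w≈b |t|≡|s| placed = lift |t|≡|s| , λ i k' 1≤i i≤n (q , moves) →
  lift (subst (λ j → t ! j ≡ s ! i) (moves w valid (w≈b q)) (placed i 1≤i i≤n))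

wf-unit : ∀ {s} → WFft (braid {s} {s} unitB)
wf-unit {s} = wf-braid-by-word {s} {s} unitB [] [] (λ q → Quotient.refl q) refl (λ _ _ _ → refl)

toPath : ∀ {a b} → Tangle a b → Path a b
toPath [ γ ]   = γ ∷ₚ nil
toPath (γ ∷ T) = γ ∷ₚ toPath T

toPath-▹ : ∀ {a b c} (T : Tangle b c) (U : Tangle a b) → toPath T ▹ U ≡ T · U
toPath-▹ [ γ ]   U = refl
toPath-▹ (γ ∷ T) U = cong (γ ∷_) (toPath-▹ T U)

◃-toPath : ∀ {a b c} (T : Tangle b c) (U : Tangle a b) → T ◃ toPath U ≡ T · U
◃-toPath T [ γ ]   = refl
◃-toPath T (γ ∷ U) = cong (T ·_) (◃-toPath [ γ ] U)

·-assoc : ∀ {a b c d} (T : Tangle c d) (U : Tangle b c) (V : Tangle a b) → (T · U) · V ≡ T · (U · V)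
·-assoc [ γ ]   U V = refl
·-assoc (γ ∷ T) U V = cong (γ ∷_) (·-assoc T U V)

≃-setoid : OWord → OWord → Setoid (lsuc 0ℓ) (lsuc 0ℓ)
≃-setoid a b = record
  { Carrier = Tangle a b ; _≈_ = _≃_
  ; isEquivalence = record { refl = ≃-refl ; sym = ≃-sym ; trans = ≃-trans } }

module ≃-Reasoning {a b : OWord} = SetoidReasoning (≃-setoid a b)

≃-move : ∀ {a b x y} (X : Path y b) (Y : Path a x) {L R : Tangle x y} → Move L R →
         {A B : Tangle a b} → A ≡ X ▹ (L ◃ Y) → B ≡ X ▹ (R ◃ Y) → WF A → WF B → A ≃ B
≃-move X Y m refl refl = ≃-step X Y m

≃-above : ∀ {a b x y} (X : Path y b) (D : Tangle a x) {L R : Tangle x y} → Move L R →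
          WF (X ▹ (L · D)) → WF (X ▹ (R · D)) → (X ▹ (L · D)) ≃ (X ▹ (R · D))
≃-above X D {L} {R} m =
  ≃-move X (toPath D) m (cong (X ▹_) (sym (◃-toPath L D))) (cong (X ▹_) (sym (◃-toPath R D)))

≃-below : ∀ {a b x y} (c : FT y b) (U : Tangle x y) {L R : Tangle a x} → Move L R →
          WF (c ∷ (U · L)) → WF (c ∷ (U · R)) → (c ∷ (U · L)) ≃ (c ∷ (U · R))
≃-below c U {L} {R} m =
  ≃-move (c ∷ₚ toPath U) nil m (cong (c ∷_) (sym (toPath-▹ U L))) (cong (c ∷_) (sym (toPath-▹ U R)))

flipK : Kappa → Kappa
flipK ud = du
flipK du = ud

flipK-word : ∀ κ (e : OWord) → _≡_ {A = OWord} (sndK κ ∷ fstK κ ∷ e) (fstK (flipK κ) ∷ sndK (flipK κ) ∷ e)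
flipK-word ud e = refl
flipK-word du e = refl

module Transpose (κ : Kappa) where

  x y : Ori
  x = fstK κ
  y = sndK κ

  xyy yxy : OWord
  xyy = x ∷ y ∷ y ∷ []
  yxy = y ∷ x ∷ y ∷ []

  -- In the paper's notation, with κ̄ = flipK κ: capL = a^{⌢κ̄ y}_{0,1}, cupR = c^{y ⌣κ}_{1,0},
  -- capR = a^{y ⌢κ}_{1,0}, cupL = c^{⌣κ̄ y}_{0,1}, capL′ = a^{⌢κ y}_{0,1}, cupL′ = c^{⌣κ y}_{0,1}.
  capL capR : FT yxy (y ∷ [])
  capL = cap [] (flipK κ) (y ∷ []) (flipK-word κ _) refl
  capR = cap (y ∷ []) κ [] refl refl

  cupL cupR : FT (y ∷ []) yxy
  cupL = cup [] (flipK κ) (y ∷ []) refl (flipK-word κ _)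
  cupR = cup (y ∷ []) κ [] refl refl

  transpose transpose′ : Tangle (x ∷ []) (x ∷ []) → Tangle (y ∷ []) (y ∷ [])
  transpose  T = [ capL ] · (tens (y ∷ []) (y ∷ []) T · [ cupR ])
  transpose′ T = [ capR ] · (tens (y ∷ []) (y ∷ []) T · [ cupL ])

  capL′ : FT xyy (y ∷ [])
  capL′ = cap [] κ (y ∷ []) refl refl

  cupL′ : FT (y ∷ []) xyy
  cupL′ = cup [] κ (y ∷ []) refl refl

  cap₀ : FT (x ∷ y ∷ []) []
  cap₀ = cap [] κ [] refl refl

  cup₀ : FT [] (x ∷ y ∷ [])
  cup₀ = cup [] κ [] refl refl

  crossing : PBraid 3 → FT xyy yxy
  crossing = braid

  crossing₂₃ : PBraid 3 → FT xyy xyy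
  crossing₂₃ = braid

  private
    1≤1 : 1 ≤ 1
    1≤1 = s≤s z≤n

    letter₁ : ∀ {n} → 1 ≤ 1 × 1 < 2 + n
    letter₁ = 1≤1 , s≤s (s≤s z≤n)

    letter₂ : ∀ {n} → 1 ≤ 2 × 2 < 3 + n
    letter₂ = s≤s z≤n , s≤s (s≤s (s≤s z≤n))

    wf-σ₁ : WFft (crossing σ₁)
    wf-σ₁ = wf-braid-by-word σ₁ ((1 , false) ∷ []) (letter₁ ∷ [])
              (λ q → Quotient.identityʳ q _) refl (inRange-by-list _ (refl ∷ refl ∷ refl ∷ []))

    wf-σ₁⁻¹ : WFft (crossing σ₁⁻¹)
    wf-σ₁⁻¹ = wf-braid-by-word σ₁⁻¹ ((1 , true) ∷ []) (letter₁ ∷ [])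
                (λ q → Quotient.identityʳ q _) refl (inRange-by-list _ (refl ∷ refl ∷ refl ∷ []))

    wf-σ₂ : WFft (crossing₂₃ σ₂)
    wf-σ₂ = wf-braid-by-word σ₂ ((2 , false) ∷ []) (letter₂ ∷ [])
              (λ q → Quotient.identityʳ q _) refl (inRange-by-list _ (refl ∷ refl ∷ refl ∷ []))

    wf-σ₁σ₂ : WFft (crossing (σ₁ ·B σ₂))
    wf-σ₁σ₂ = wf-braid-by-word (σ₁ ·B σ₂) ((1 , false) ∷ (2 , false) ∷ []) (letter₁ ∷ letter₂ ∷ [])
                (λ q → Quotient.∙-congˡ q (Quotient.identityʳ q _)) refl
                (inRange-by-list _ (refl ∷ refl ∷ refl ∷ []))

    wf-σ₁⁻¹σ₂⁻¹ : WFft (crossing (σ₁⁻¹ ·B σ₂⁻¹))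
    wf-σ₁⁻¹σ₂⁻¹ = wf-braid-by-word (σ₁⁻¹ ·B σ₂⁻¹) ((1 , true) ∷ (2 , true) ∷ []) (letter₁ ∷ letter₂ ∷ [])
                    (λ q → Quotient.∙-congˡ q (Quotient.identityʳ q _)) refl
                    (inRange-by-list _ (refl ∷ refl ∷ refl ∷ []))

    wf-σ₁⁻¹σ₂⁻¹σ₂ : WFft (crossing ((σ₁⁻¹ ·B σ₂⁻¹) ·B σ₂))
    wf-σ₁⁻¹σ₂⁻¹σ₂ = wf-braid-by-word ((σ₁⁻¹ ·B σ₂⁻¹) ·B σ₂) ((1 , true) ∷ (2 , true) ∷ (2 , false) ∷ [])
                      (letter₁ ∷ letter₂ ∷ letter₂ ∷ [])
                      (λ q → Quotient.trans q (Quotient.∙-congˡ q (Quotient.∙-congˡ q (Quotient.identityʳ q _)))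
                                              (Quotient.sym q (Quotient.assoc q _ _ _)))
                      refl (inRange-by-list _ (refl ∷ refl ∷ refl ∷ []))

    wf-σ₁-on-two : WFft (braid {x ∷ y ∷ []} {y ∷ x ∷ []} σ₁)
    wf-σ₁-on-two = wf-braid-by-word σ₁ ((1 , false) ∷ []) (letter₁ ∷ [])
                     (λ q → Quotient.identityʳ q _) refl (inRange-by-list _ (refl ∷ refl ∷ []))

    wf-σ₁⁻¹-on-two : WFft (braid {x ∷ y ∷ []} {y ∷ x ∷ []} σ₁⁻¹)
    wf-σ₁⁻¹-on-two = wf-braid-by-word σ₁⁻¹ ((1 , true) ∷ []) (letter₁ ∷ [])
                       (λ q → Quotient.identityʳ q _) refl (inRange-by-list _ (refl ∷ refl ∷ []))

  σ₁⁻¹σ₂⁻¹σ₂≈σ₁⁻¹ : ((σ₁⁻¹ ·B σ₂⁻¹) ·B σ₂) ≈B σ₁⁻¹ {1}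
  σ₁⁻¹σ₂⁻¹σ₂≈σ₁⁻¹ = lift λ q →
    Quotient.trans q (Quotient.assoc q _ _ _)
                     (Quotient.trans q (Quotient.∙-congˡ q (Quotient.inverseˡ q _)) (Quotient.identityʳ q _))

  cup-through-crossing : ∀ {b} (c : FT yxy b) (U : Tangle yxy yxy) → WFft c → WF U →
                         (c ∷ (U · [ cupR ])) ≃ (c ∷ (U · (crossing (σ₁ ·B σ₂) ∷ [ cupL′ ])))
  cup-through-crossing c U wfc wfU = begin
    c ∷ (U · [ cupR ])
      ≈⟨ ≃-below c U (T1r [ cupR ]) (wfc , wf-· U _ wfU (_ , wf-unit)) (wfc , wf-· U _ wfU _) ⟨
    c ∷ (U · (cupR ∷ [ idFT ]))
      ≈⟨ ≃-below c U (T4 {x ∷ y ∷ []} {y ∷ x ∷ []} σ₁ wf-σ₁-on-two 1 2 1≤1 (s≤s z≤n)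
                         (perm-symQuotient (s≤s (s≤s z≤n)) σ₁ 1) [ cup₀ ] _ unitB cab-σ₁ (cab-erase₂ σ₁))
           (wfc , wf-· U _ wfU (wf-σ₁σ₂ , _)) (wfc , wf-· U _ wfU (_ , wf-unit)) ⟨
    c ∷ (U · (crossing (σ₁ ·B σ₂) ∷ [ cupL′ ])) ∎
    where open ≃-Reasoning

  slide-through : (T : Tangle (x ∷ []) (x ∷ [])) → WF T → ∀ {b} (c : FT yxy b) (β : PBraid 3) →
                  WFft c → WFft (crossing β) → Perm β 1 2 →
                  (c ∷ crossing β ∷ (tens [] (y ∷ y ∷ []) T · [ cupL′ ]))
                    ≃ (c ∷ (tens (y ∷ []) (y ∷ []) T · (crossing β ∷ [ cupL′ ])))
  slide-through T wfT c β wfc wfβ β₁↦₂ =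
    ≃-move (c ∷ₚ nil) (cupL′ ∷ₚ nil)
      (T4 {xyy} {yxy} β wfβ 1 2 1≤1 (s≤s z≤n) β₁↦₂ T β β (cab-single 1 β) (cab-single 1 β))
      refl (cong (c ∷_) (sym (·-assoc (tens (y ∷ []) (y ∷ []) T) [ crossing β ] [ cupL′ ])))
      (wfc , wfβ , wf-· (tens [] (y ∷ y ∷ []) T) [ cupL′ ] (wf-tens [] (y ∷ y ∷ []) T wfT) _)
      (wfc , wf-· (tens (y ∷ []) (y ∷ []) T) (crossing β ∷ [ cupL′ ]) (wf-tens (y ∷ []) (y ∷ []) T wfT) (wfβ , _))

  cap-through-crossing : ∀ {a} (D : Tangle a xyy) → WF D →
                         (capL ∷ crossing (σ₁ ·B σ₂) ∷ D) ≃ (capR ∷ crossing σ₁⁻¹ ∷ D)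
  cap-through-crossing D wfD = begin
    capL ∷ crossing (σ₁ ·B σ₂) ∷ D
      ≈⟨ ≃-above (capL ∷ₚ nil) D (T2 σ₂ σ₁ refl) (_ , wf-σ₁ , wf-σ₂ , wfD) (_ , wf-σ₁σ₂ , wfD) ⟨
    capL ∷ crossing σ₁ ∷ crossing₂₃ σ₂ ∷ D
      ≈⟨ ≃-above nil (crossing₂₃ σ₂ ∷ D)
           (T6a [] (y ∷ []) (flipK κ) κ (flipK-word κ _) refl refl refl oneẐ 1≤1 (s≤s (s≤s z≤n)))
           (_ , wf-σ₁ , wf-σ₂ , wfD) (_ , wf-σ₂ , wfD) ⟩
    capL′ ∷ crossing₂₃ σ₂ ∷ D
      ≈⟨ ≃-above nil (crossing₂₃ σ₂ ∷ D) (T1l [ capL′ ]) (wf-unit , _ , wf-σ₂ , wfD) (_ , wf-σ₂ , wfD) ⟨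
    idFT ∷ capL′ ∷ crossing₂₃ σ₂ ∷ D
      ≈⟨ ≃-above nil (crossing₂₃ σ₂ ∷ D)
           (T4 {x ∷ y ∷ []} {y ∷ x ∷ []} σ₁⁻¹ wf-σ₁⁻¹-on-two 1 2 1≤1 (s≤s z≤n)
               (perm-symQuotient (s≤s (s≤s z≤n)) σ₁⁻¹ 1) [ cap₀ ] unitB _ (cab-erase₂ σ₁⁻¹) cab-σ₁⁻¹)
           (wf-unit , _ , wf-σ₂ , wfD) (_ , wf-σ₁⁻¹σ₂⁻¹ , wf-σ₂ , wfD) ⟩
    capR ∷ crossing (σ₁⁻¹ ·B σ₂⁻¹) ∷ crossing₂₃ σ₂ ∷ D
      ≈⟨ ≃-above (capR ∷ₚ nil) D (T2 σ₂ (σ₁⁻¹ ·B σ₂⁻¹) refl)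
           (_ , wf-σ₁⁻¹σ₂⁻¹ , wf-σ₂ , wfD) (_ , wf-σ₁⁻¹σ₂⁻¹σ₂ , wfD) ⟩
    capR ∷ crossing ((σ₁⁻¹ ·B σ₂⁻¹) ·B σ₂) ∷ D
      ≈⟨ ≃-above (capR ∷ₚ nil) D (Bcong _ _ σ₁⁻¹σ₂⁻¹σ₂≈σ₁⁻¹) (_ , wf-σ₁⁻¹σ₂⁻¹σ₂ , wfD) (_ , wf-σ₁⁻¹ , wfD) ⟩
    capR ∷ crossing σ₁⁻¹ ∷ D ∎
    where open ≃-Reasoning

  transpose≃transpose′ : (T : Tangle (x ∷ []) (x ∷ [])) → WF T → transpose T ≃ transpose′ T
  transpose≃transpose′ T wfT = begin
    transpose T
      ≈⟨ cup-through-crossing capL T′ _ wfT′ ⟩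
    capL ∷ (T′ · (crossing (σ₁ ·B σ₂) ∷ [ cupL′ ]))
      ≈⟨ slide-through T wfT capL (σ₁ ·B σ₂) _ wf-σ₁σ₂ (perm-symQuotient ≤-refl (σ₁ ·B σ₂) 1) ⟨
    capL ∷ crossing (σ₁ ·B σ₂) ∷ D
      ≈⟨ cap-through-crossing D wfD ⟩
    capR ∷ crossing σ₁⁻¹ ∷ D
      ≈⟨ slide-through T wfT capR σ₁⁻¹ _ wf-σ₁⁻¹ (perm-symQuotient ≤-refl σ₁⁻¹ 1) ⟩
    capR ∷ (T′ · (crossing σ₁⁻¹ ∷ [ cupL′ ]))
      ≈⟨ ≃-below capR T′ (T6c [] (y ∷ []) κ (flipK κ) refl refl refl (flipK-word κ _) minusOneẐ 1≤1 (s≤s (s≤s z≤n)))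
           (_ , wf-· T′ _ wfT′ (wf-σ₁⁻¹ , _)) (_ , wf-· T′ _ wfT′ _) ⟩
    transpose′ T ∎
    where
    open ≃-Reasoning
    T′ : Tangle yxy yxy
    T′ = tens (y ∷ []) (y ∷ []) T
    wfT′ : WF T′
    wfT′ = wf-tens (y ∷ []) (y ∷ []) T wfT
    D : Tangle (y ∷ []) xyy
    D = tens [] (y ∷ y ∷ []) T · [ cupL′ ]
    wfD : WF D
    wfD = wf-· (tens [] (y ∷ y ∷ []) T) [ cupL′ ] (wf-tens [] (y ∷ y ∷ []) T wfT) _

lemma2p16 : ((T : Tangle (up ∷ []) (up ∷ [])) → WF T → transpose↑ T ≃ transpose↑' T)
            × ((T : Tangle (down ∷ []) (down ∷ [])) → WF T → transpose↓ T ≃ transpose↓' T)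
lemma2p16 = Transpose.transpose≃transpose′ ud , Transpose.transpose≃transpose′ du
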